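{- Let $m\in\mathbb{N}$, $k\in\mathbb{N}$, $e\in\mathrm{E}_m$ and $a,b\in\mathrm{R}_m^e$ such that $\mathrm{ind}_b^m a$ exists. Then \[ (k,|b|_m)\mid\mathrm{ind}_b^m a \iff a^{\frac{|b|_m}{(k,|b|_m)}}\bmod m\in\mathrm{E}_m. \]
   Context: $\mathbb{N}=\{1,2,\dots\}$, $\mathbb{Z}_m=\{1,\dots,m\}$, $x\bmod m$ denotes the element of $\mathbb{Z}_m$ congruent to $x$, $(u,v)$ is the gcd. $\mathrm{E}_m=\{e\in\mathbb{Z}_m: e^2\equiv e\pmod m\}$. For $a\in\mathbb{Z}$, $|a|_m$ is the smallest $n\in\mathbb{N}$ with $a^n\bmod m\in\mathrm{E}_m$. $a\in\mathbb{Z}_m$ is regular if $a^{|a|_m+1}\equiv a\pmod m$; $\mathrm{R}_m$ is the set of regular residues; for $e\in\mathrm{E}_m$, $\mathrm{R}_m^e=\{a\in\mathrm{R}_m: a^{|a|_m}\equiv e\pmod m\}$. For $a,b\in\mathbb{Z}_m$, the index $\mathrm{ind}_b^m a$ is the smallest $n\in\mathbb{N}$ with $b^n\equiv a\pmod m$, when such $n$ exists. -}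

module Defs where

open import Data.Nat using (ℕ; zero; suc; _+_; _*_; _^_; _≤_; _<_; NonZero; ≢-nonZero; _≟_)
open import Data.Nat.DivMod using (_%_; _/_)
open import Data.Nat.GCD using (gcd; gcd[m,n]≢0)
open import Data.Product using (_×_)
open import Data.Sum using (inj₁)
open import Relation.Binary.PropositionalEquality using (_≡_)
open import Relation.Nullary using (¬_; yes; no)

Cong : (m : ℕ) → .{{NonZero m}} → ℕ → ℕ → Set
Cong m x y = x % m ≡ y % m

InZ : ℕ → ℕ → Set
InZ m x = (1 ≤ x) × (x ≤ m)

-- x mod m : the element of Z_m = {1,…,m} congruent to x
modZ : (m : ℕ) → .{{NonZero m}} → ℕ → ℕ
modZ m x with x % m ≟ 0
... | yes _ = m
... | no _  = x % m

InE : (m : ℕ) → .{{NonZero m}} → ℕ → Set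
InE m e = InZ m e × Cong m (e * e) e

IsOrd : (m : ℕ) → .{{NonZero m}} → ℕ → ℕ → Set
IsOrd m a n = (1 ≤ n) × InE m (modZ m (a ^ n))
            × (∀ j → 1 ≤ j → j < n → ¬ InE m (modZ m (a ^ j)))

-- a ∈ R_m^e, given that na = |a|_m
InRe : (m : ℕ) → .{{NonZero m}} → ℕ → ℕ → ℕ → Set
InRe m e a na = InZ m a × Cong m (a ^ (na + 1)) a × Cong m (a ^ na) e

IsInd : (m : ℕ) → .{{NonZero m}} → ℕ → ℕ → ℕ → Set
IsInd m b a i = (1 ≤ i) × Cong m (b ^ i) a
              × (∀ j → 1 ≤ j → j < i → ¬ Cong m (b ^ j) a)

divGcd : (k n : ℕ) → .{{NonZero k}} → ℕ
divGcd (suc k) n = _/_ n (gcd (suc k) n) {{≢-nonZero (gcd[m,n]≢0 (suc k) n (inj₁ (λ ())))}}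

module Submission where

-- Write x ≈ y for congruence modulo m and call x idempotent
-- when x * x ≈ y.  Since b is regular with |b|_m = nb and b^nb ≡ e, the powers
-- of b are periodic with period nb, and by minimality of nb the only positive
-- exponents j with b^j ≡ e are the multiples of nb.  With g = (k, nb) and
-- q = nb / g we have a^q ≡ b^(iq), because a ≡ b^i.  The theorem is then the
-- chain of equivalences
--   g ∣ i  ⇔  nb ∣ iq  ⇔  b^(iq) ≡ e  ⇔  a^q ≡ e  ⇔  a^q idempotent  ⇔  a^q mod m ∈ E_m,
-- where the fourth step uses that an idempotent positive power of a is
-- congruent to e (because a^na ≡ e), and the last one that x mod m ∈ E_m
-- exactly when x is idempotent modulo m.

open import Defs
open import Data.Nat using (ℕ; zero; suc; _+_; _*_; _^_; _≤_; _<_; _%_; _/_; _≟_; z≤n; s≤s; NonZero; >-nonZero; >-nonZero⁻¹; ≢-nonZero)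
open import Data.Nat.Properties
open import Data.Nat.DivMod using (%-distribˡ-*; n%n≡0; m%n%n≡m%n; m%n<n; m≡m%n+[m/n]*n; m*[n/m]≡n)
open import Data.Nat.Divisibility using (_∣_; divides; m%n≡0⇒n∣m; *-monoˡ-∣; *-cancelʳ-∣)
open import Data.Nat.GCD using (gcd; gcd[m,n]∣n; gcd[m,n]≢0)
open import Data.Product using (_,_; proj₁)
open import Data.Sum using (inj₁)
open import Data.Empty using (⊥-elim)
open import Function.Bundles using (_⇔_; mk⇔; Equivalence)
open import Function.Construct.Symmetry using (⇔-sym)
open import Function.Related.Propositional using (module EquationalReasoning)
open import Relation.Binary.PropositionalEquality using (_≡_; refl; sym; trans; cong; cong₂; subst; module ≡-Reasoning)
open import Relation.Nullary using (yes; no)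

module Modular (m : ℕ) .{{_ : NonZero m}} where

  infix 4 _≈_
  _≈_ : ℕ → ℕ → Set
  x ≈ y = Cong m x y

  ≡⇒≈ : ∀ {x y} → x ≡ y → x ≈ y
  ≡⇒≈ = cong (_% m)

  *-cong : ∀ {x x′ y y′} → x ≈ x′ → y ≈ y′ → x * y ≈ x′ * y′
  *-cong {x} {x′} {y} {y′} x≈x′ y≈y′ = begin
    (x * y) % m                    ≡⟨ %-distribˡ-* x y m ⟩
    ((x % m) * (y % m)) % m        ≡⟨ cong₂ (λ u v → (u * v) % m) x≈x′ y≈y′ ⟩
    ((x′ % m) * (y′ % m)) % m      ≡⟨ %-distribˡ-* x′ y′ m ⟨
    (x′ * y′) % m                  ∎
    where open ≡-Reasoning

  ^-cong : ∀ {x y} n → x ≈ y → x ^ n ≈ y ^ n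
  ^-cong zero    x≈y = refl
  ^-cong (suc n) x≈y = *-cong x≈y (^-cong n x≈y)

  ≈-transport : ∀ {x y z} → x ≈ y → (x ≈ z ⇔ y ≈ z)
  ≈-transport x≈y = mk⇔ (trans (sym x≈y)) (trans x≈y)

  Idempotent : ℕ → Set
  Idempotent x = x * x ≈ x

  idempotent-cong : ∀ {x y} → x ≈ y → Idempotent x → Idempotent y
  idempotent-cong x≈y xx≈x = trans (*-cong (sym x≈y) (sym x≈y)) (trans xx≈x x≈y)

  idempotent-^ : ∀ {y} → Idempotent y → ∀ t → y ^ suc t ≈ y
  idempotent-^ {y} yy≈y zero    = ≡⇒≈ (*-identityʳ y)
  idempotent-^ {y} yy≈y (suc t) = trans (*-cong {y} refl (idempotent-^ yy≈y t)) yy≈y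

  modZ-≈ : ∀ x → modZ m x ≈ x
  modZ-≈ x with x % m ≟ 0
  ... | yes x%m≡0 = trans (n%n≡0 m) (sym x%m≡0)
  ... | no  _     = m%n%n≡m%n x m

  modZ-InZ : ∀ x → InZ m (modZ m x)
  modZ-InZ x with x % m ≟ 0
  ... | yes _     = >-nonZero⁻¹ m , ≤-refl
  ... | no  x%m≢0 = n≢0⇒n>0 x%m≢0 , <⇒≤ (m%n<n x m)

  InE-modZ⇔idempotent : ∀ x → InE m (modZ m x) ⇔ Idempotent x
  InE-modZ⇔idempotent x = mk⇔
    (λ (_ , idem) → idempotent-cong (modZ-≈ x) idem)
    (λ idem → modZ-InZ x , idempotent-cong (sym (modZ-≈ x)) idem)

  -- If x^n ≡ e for an idempotent e, then a positive power of x is idempotent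
  -- iff it is congruent to e: indeed x^j ≡ (x^j)^n = (x^n)^j ≡ e^j ≡ e.
  idempotent-power⇔≈ : ∀ {x e n j} → Idempotent e → 1 ≤ n → x ^ n ≈ e →
                       1 ≤ j → (x ^ j ≈ e ⇔ Idempotent (x ^ j))
  idempotent-power⇔≈ {x} {e} {suc n} {suc j} ee≈e _ xⁿ≈e _ =
    mk⇔ (λ xʲ≈e → idempotent-cong (sym xʲ≈e) ee≈e) ≈e
    where
    ≈e : Idempotent (x ^ suc j) → x ^ suc j ≈ e
    ≈e xʲ-idem = begin
      (x ^ suc j) % m              ≡⟨ idempotent-^ xʲ-idem n ⟨
      ((x ^ suc j) ^ suc n) % m    ≡⟨ ≡⇒≈ (^-*-assoc x (suc j) (suc n)) ⟩
      (x ^ (suc j * suc n)) % m    ≡⟨ ≡⇒≈ (cong (x ^_) (*-comm (suc j) (suc n))) ⟩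
      (x ^ (suc n * suc j)) % m    ≡⟨ ≡⇒≈ (^-*-assoc x (suc n) (suc j)) ⟨
      ((x ^ suc n) ^ suc j) % m    ≡⟨ ^-cong (suc j) xⁿ≈e ⟩
      (e ^ suc j) % m              ≡⟨ idempotent-^ ee≈e j ⟩
      e % m                        ∎
      where open ≡-Reasoning

  module Periodic {b n : ℕ} (b^[1+n]≈b : b ^ suc n ≈ b) where

    shift : ∀ s → b ^ (suc s + n) ≈ b ^ suc s
    shift s = begin
      (b ^ (suc s + n)) % m        ≡⟨ ≡⇒≈ (cong (b ^_) (+-suc s n)) ⟨
      (b ^ (s + suc n)) % m        ≡⟨ ≡⇒≈ (^-distribˡ-+-* b s (suc n)) ⟩
      (b ^ s * b ^ suc n) % m      ≡⟨ *-cong {b ^ s} refl b^[1+n]≈b ⟩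
      (b ^ s * b) % m              ≡⟨ ≡⇒≈ (*-comm (b ^ s) b) ⟩
      (b ^ suc s) % m              ∎
      where open ≡-Reasoning

    periodic : ∀ r t → b ^ (suc r + t * n) ≈ b ^ suc r
    periodic r zero    = ≡⇒≈ (cong (b ^_) (+-identityʳ (suc r)))
    periodic r (suc t) = begin
      (b ^ (suc r + (n + t * n))) % m  ≡⟨ ≡⇒≈ (cong (b ^_) (exponent r)) ⟩
      (b ^ (suc (r + t * n) + n)) % m  ≡⟨ shift (r + t * n) ⟩
      (b ^ (suc r + t * n)) % m        ≡⟨ periodic r t ⟩
      (b ^ suc r) % m                  ∎
      where
      open ≡-Reasoning
      exponent : ∀ r → suc r + (n + t * n) ≡ suc (r + t * n) + n
      exponent r = cong suc (trans (cong (r +_) (+-comm n (t * n))) (sym (+-assoc r (t * n) n)))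

  -- A nonzero
  -- remainder r = j mod n would give an idempotent b^r with 1 ≤ r < n,
  -- contradicting the minimality of n.
  ≈e⇔order∣ : ∀ {b n e} → Idempotent e → IsOrd m b n →
              b ^ (n + 1) ≈ b → b ^ n ≈ e →
              ∀ j → 1 ≤ j → (b ^ j ≈ e ⇔ n ∣ j)
  ≈e⇔order∣ {b} {suc n} {e} ee≈e (_ , _ , minimal) b^[n+1]≈b bⁿ≈e j j≥1 =
    mk⇔ order∣ ≈e
    where
    open Periodic {b} {suc n} (trans (≡⇒≈ (cong (b ^_) (+-comm 1 (suc n)))) b^[n+1]≈b)

    order∣ : b ^ j ≈ e → suc n ∣ j
    order∣ bʲ≈e with j % suc n in j%n≡r
    ... | zero  = m%n≡0⇒n∣m j (suc n) j%n≡r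
    ... | suc r = ⊥-elim (minimal (suc r) (s≤s z≤n) r<n
                    (Equivalence.from (InE-modZ⇔idempotent (b ^ suc r))
                      (idempotent-cong (sym bʳ≈e) ee≈e)))
      where
      r<n : suc r < suc n
      r<n = subst (_< suc n) j%n≡r (m%n<n j (suc n))
      bʳ≈e : b ^ suc r ≈ e
      bʳ≈e = begin
        (b ^ suc r) % m                        ≡⟨ periodic r (j / suc n) ⟨
        (b ^ (suc r + j / suc n * suc n)) % m  ≡⟨ ≡⇒≈ (cong (λ s → b ^ (s + j / suc n * suc n)) j%n≡r) ⟨
        (b ^ (j % suc n + j / suc n * suc n)) % m ≡⟨ ≡⇒≈ (cong (b ^_) (m≡m%n+[m/n]*n j (suc n))) ⟨
        (b ^ j) % m                            ≡⟨ bʲ≈e ⟩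
        e % m                                  ∎
        where open ≡-Reasoning

    ≈e : suc n ∣ j → b ^ j ≈ e
    ≈e (divides zero    j≡0)     = ⊥-elim (<⇒≢ j≥1 (sym j≡0))
    ≈e (divides (suc t) j≡[1+t]n) =
      trans (≡⇒≈ (cong (b ^_) j≡[1+t]n)) (trans (periodic n t) bⁿ≈e)

gcd*divGcd : ∀ k n .{{_ : NonZero k}} → gcd k n * divGcd k n ≡ n
gcd*divGcd (suc k) n = m*[n/m]≡n {{gcd≢0}} (gcd[m,n]∣n (suc k) n)
  where
  gcd≢0 : NonZero (gcd (suc k) n)
  gcd≢0 = ≢-nonZero (gcd[m,n]≢0 (suc k) n (inj₁ (λ ())))

divGcd-positive : ∀ k n .{{_ : NonZero k}} → 1 ≤ n → 1 ≤ divGcd k n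
divGcd-positive k n n≥1 with divGcd k n in q≡d
... | suc _ = s≤s z≤n
... | zero  = ⊥-elim (<⇒≢ n≥1 (sym (begin
  n                     ≡⟨ gcd*divGcd k n ⟨
  gcd k n * divGcd k n  ≡⟨ cong (gcd k n *_) q≡d ⟩
  gcd k n * 0           ≡⟨ *-zeroʳ (gcd k n) ⟩
  0                     ∎)))
  where open ≡-Reasoning

∣⇔*∣* : ∀ {d i} q .{{_ : NonZero q}} → d ∣ i ⇔ d * q ∣ i * q
∣⇔*∣* q = mk⇔ (*-monoˡ-∣ q) (*-cancelʳ-∣ q)

proposition2p15 : (m k e a b : ℕ) → .{{_ : NonZero m}} → .{{_ : NonZero k}} →
    InE m e →
    (na nb : ℕ) → IsOrd m a na → IsOrd m b nb →
    InRe m e a na → InRe m e b nb →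
    (i : ℕ) → IsInd m b a i →
    (gcd k nb ∣ i) ⇔ InE m (modZ m (a ^ divGcd k nb))
proposition2p15 m k e a b (_ , ee≈e) na nb (na≥1 , _) ordB (_ , _ , aⁿᵃ≈e)
                (_ , b^[nb+1]≈b , bⁿᵇ≈e) i (i≥1 , bⁱ≈a , _) =
  begin
    gcd k nb ∣ i            ∼⟨ ∣⇔*∣* q ⟩
    gcd k nb * q ∣ i * q    ≡⟨ cong (_∣ i * q) (gcd*divGcd k nb) ⟩
    nb ∣ i * q              ∼⟨ ⇔-sym (≈e⇔order∣ ee≈e ordB b^[nb+1]≈b bⁿᵇ≈e (i * q) iq≥1) ⟩
    b ^ (i * q) ≈ e         ∼⟨ ≈-transport (sym aᵠ≈bⁱᵠ) ⟩
    a ^ q ≈ e               ∼⟨ idempotent-power⇔≈ ee≈e na≥1 aⁿᵃ≈e q≥1 ⟩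
    Idempotent (a ^ q)      ∼⟨ ⇔-sym (InE-modZ⇔idempotent (a ^ q)) ⟩
    InE m (modZ m (a ^ q))  ∎
  where
  open Modular m
  open EquationalReasoning
  q : ℕ
  q = divGcd k nb
  q≥1 : 1 ≤ q
  q≥1 = divGcd-positive k nb (proj₁ ordB)
  instance
    q≢0 : NonZero q
    q≢0 = >-nonZero q≥1
  iq≥1 : 1 ≤ i * q
  iq≥1 = *-mono-≤ i≥1 q≥1
  -- a ≡ b^i, hence a^q ≡ (b^i)^q = b^(iq)
  aᵠ≈bⁱᵠ : a ^ q ≈ b ^ (i * q)
  aᵠ≈bⁱᵠ = trans (^-cong q (sym bⁱ≈a)) (≡⇒≈ (^-*-assoc b i q))
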